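{- In the fully-online setting, no deterministic algorithm for non-preemptive makespan minimization on two identical machines with testing is $c$-competitive for any $c<2.0953$.
   Context: Scheduling with testing on identical parallel machines: each job $j$ has a testing time $t_j\ge 0$, an upper bound $u_j\ge 0$ and a processing time $p_j$ with $0\le p_j\le u_j$. A job can either be run untested, occupying a machine for time $u_j$, or be tested and then executed, occupying a machine for total time $t_j+p_j$; the value $p_j$ is revealed to the algorithm only when the test of $j$ is completed. Fully-online setting: jobs arrive one by one; when job $j$ arrives its $t_j$ and $u_j$ are revealed, and the algorithm must irrevocably decide whether to test it and to which machine to assign it before the next job arrives. Non-preemptive: each job runs without interruption on its assigned machine. The objective is the makespan. $\mathrm{OPT}$ denotes the minimum makespan achievable by an offline scheduler knowing the whole instance including all $p_j$ (job $j$ needs time $\min(t_j+p_j,u_j)$ in the optimum). A deterministic algorithm is $c$-competitive if $\mathrm{ALG}\le c\cdot\mathrm{OPT}$ on every instance.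
   Formalization: The ratio c ranges over the rationals, and the testing times $t_j$, upper bounds $u_j$ and processing times $p_j$ of the instances are taken in the rationals. -}

module Defs where

open import Data.Bool using (Bool; true; false; if_then_else_)
open import Data.Fin using (Fin; zero; suc)
open import Data.List using (List; []; _∷_; _++_)
open import Data.List.Relation.Unary.All using (All)
open import Data.Maybe using (Maybe; just; nothing)
open import Data.Product using (_×_; _,_)
open import Data.Integer using (+_)
open import Data.Rational using (ℚ; 0ℚ; _+_; _*_; _≤_; _<_; _⊔_; _⊓_; _/_)
open import Relation.Nullary using (¬_)

-- A job: testing time t, upper bound u, processing time p.
record Job : Set where
  constructor job
  field
    t u p : ℚ
open Job public

ValidJob : Job → Set
ValidJob j = (0ℚ ≤ t j) × (0ℚ ≤ p j) × (p j ≤ u j)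

-- Decision made when a job arrives: whether to test it, and the machine (2 machines).
Decision : Set
Decision = Bool × Fin 2

-- What the algorithm observes about a past job: t, u, its own decision,
-- and p only if the job was tested.
record Obs : Set where
  constructor obs
  field
    ot ou : ℚ
    odec  : Decision
    orev  : Maybe ℚ

-- A deterministic fully-online algorithm: given the history of observations
-- (in arrival order) and the (t,u) of the newly arrived job, it decides.
Algorithm : Set
Algorithm = List Obs → ℚ → ℚ → Decision

observe : Job → Decision → Obs
observe j (b , m) = obs (t j) (u j) (b , m) (if b then just (p j) else nothing)

timeOf : Job → Bool → ℚ
timeOf j true  = t j + p j
timeOf j false = u j

runFrom : Algorithm → List Obs → ℚ → ℚ → List Job → ℚ
runFrom A h l0 l1 [] = l0 ⊔ l1
runFrom A h l0 l1 (j ∷ js) with A h (t j) (u j)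
... | (b , zero)  = runFrom A (h ++ (observe j (b , zero) ∷ [])) (l0 + timeOf j b) l1 js
... | (b , suc _) = runFrom A (h ++ (observe j (b , suc zero) ∷ [])) l0 (l1 + timeOf j b) js

ALG : Algorithm → List Job → ℚ
ALG A I = runFrom A [] 0ℚ 0ℚ I

optTime : Job → ℚ
optTime j = (t j + p j) ⊓ u j

bestFrom : ℚ → ℚ → List Job → ℚ
bestFrom l0 l1 [] = l0 ⊔ l1
bestFrom l0 l1 (j ∷ js) = bestFrom (l0 + optTime j) l1 js ⊓ bestFrom l0 (l1 + optTime j) js

OPT : List Job → ℚ
OPT I = bestFrom 0ℚ 0ℚ I

Competitive : Algorithm → ℚ → Set
Competitive A c = (I : List Job) → All ValidJob I → ALG A I ≤ c * OPT I

bound : ℚ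
bound = + 20953 / 10000

-- An adaptive adversary releases at most three jobs. A job the algorithm tests turns out to need
-- its whole upper bound, and a job it runs untested would have needed no time at all, so every
-- testing decision is the wrong one. If the second job is put on the machine of the first, the
-- ratio is already at least 2.0953; otherwise a third job, sized according to both testing
-- decisions, enforces it. The resulting 40 instances are checked by exact rational arithmetic.
module Submission where

open import Defs
open import Data.Rational using (ℚ; _<_)
open import Relation.Nullary using (¬_)

open import Data.Bool using (Bool; true; false; if_then_else_)
open import Data.Fin using (zero; suc)
import Data.Fin as Fin
open import Data.List using (List; []; _∷_; _++_; [_])
open import Data.List.Properties using (++-assoc; ++-identityʳ)
open import Data.List.Relation.Unary.All using (All; []; _∷_)
open import Data.Product using (_×_; _,_; proj₁; proj₂; uncurry)
open import Data.Integer using (+_)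
open import Data.Rational using (0ℚ; 1ℚ; _≤_; _/_; _*_; _+_; _⊔_; _≤?_; _<?_; positive)
open import Data.Rational.Properties using (*-monoˡ-<-pos; <-irrefl; module ≤-Reasoning)
open import Relation.Nullary using (Dec; yes; no; does; _×-dec_)
open import Relation.Nullary.Decidable using (toWitness)
open import Relation.Binary.PropositionalEquality using (_≡_; refl; sym; subst₂)
open import Data.Unit using (tt)

-- The algorithm is deterministic, so the adversary may fix pⱼ after seeing the decision on job j.
data Adversary : Set where
  stop : Adversary
  ask  : (tⱼ uⱼ : ℚ) (pⱼ : Decision → ℚ) (next : Decision → Adversary) → Adversary

play : Algorithm → List Obs → Adversary → List Job
play A h stop                = []
play A h (ask tⱼ uⱼ pⱼ next) = j ∷ play A (h ++ [ observe j d ]) (next d)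
  where
  d : Decision
  d = A h tⱼ uⱼ
  j : Job
  j = job tⱼ uⱼ (pⱼ d)

Loads : Set
Loads = ℚ × ℚ

place : Decision → Job → Loads → Loads
place (b , zero)  j (l₀ , l₁) = l₀ + timeOf j b , l₁
place (b , suc _) j (l₀ , l₁) = l₀ , l₁ + timeOf j b

runFrom-∷ : ∀ A h l₀ l₁ j js {d} → A h (t j) (u j) ≡ d →
            runFrom A h l₀ l₁ (j ∷ js) ≡ uncurry (runFrom A (h ++ [ observe j d ])) (place d j (l₀ , l₁)) js
runFrom-∷ A h l₀ l₁ j js refl with A h (t j) (u j)
... | b , zero     = refl
... | b , suc zero = refl

-- I lists the jobs released so far and ls the machine loads they produced.
Forces : ℚ → Loads → List Job → Adversary → Set
Forces ρ (l₀ , l₁) I stop = 0ℚ < OPT I × ρ * OPT I ≤ l₀ ⊔ l₁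
Forces ρ ls I (ask tⱼ uⱼ pⱼ next) =
  ∀ d → let j = job tⱼ uⱼ (pⱼ d) in ValidJob j × Forces ρ (place d j ls) (I ++ [ j ]) (next d)

module _ {ρ : ℚ} (A : Algorithm) where

  play-valid : ∀ h ls I T → Forces ρ ls I T → All ValidJob (play A h T)
  play-valid h ls I stop                F = []
  play-valid h ls I (ask tⱼ uⱼ pⱼ next) F =
    let d = A h tⱼ uⱼ ; j = job tⱼ uⱼ (pⱼ d) ; (valid , rest) = F d
    in valid ∷ play-valid (h ++ [ observe j d ]) (place d j ls) (I ++ [ j ]) (next d) rest

  play-ratio : ∀ h ls I T → Forces ρ ls I T →
               let J = I ++ play A h T in 0ℚ < OPT J × ρ * OPT J ≤ uncurry (runFrom A h) ls (play A h T)
  play-ratio h (l₀ , l₁) I stop F rewrite ++-identityʳ I = F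
  play-ratio h (l₀ , l₁) I (ask tⱼ uⱼ pⱼ next) F =
    subst₂ (λ J m → 0ℚ < OPT J × ρ * OPT J ≤ m) (++-assoc I [ j ] js) (sym (runFrom-∷ A h l₀ l₁ j js refl))
      (play-ratio h′ (place d j (l₀ , l₁)) (I ++ [ j ]) (next d) (proj₂ (F d)))
    where
    d : Decision
    d = A h tⱼ uⱼ
    j : Job
    j = job tⱼ uⱼ (pⱼ d)
    h′ : List Obs
    h′ = h ++ [ observe j d ]
    js : List Job
    js = play A h′ (next d)

Forces⇒¬Competitive : ∀ {ρ c} T → Forces ρ (0ℚ , 0ℚ) [] T → c < ρ → ∀ A → ¬ Competitive A c
Forces⇒¬Competitive {ρ} {c} T F c<ρ A competitive = <-irrefl refl (begin-strict
  c * OPT I  <⟨ *-monoˡ-<-pos (OPT I) {{positive OPT>0}} c<ρ ⟩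
  ρ * OPT I  ≤⟨ ρOPT≤ALG ⟩
  ALG A I    ≤⟨ competitive I (play-valid A [] _ _ T F) ⟩
  c * OPT I  ∎)
  where
  open ≤-Reasoning
  I : List Job
  I = play A [] T
  OPT>0 : 0ℚ < OPT I
  OPT>0 = proj₁ (play-ratio A [] _ _ T F)
  ρOPT≤ALG : ρ * OPT I ≤ ALG A I
  ρOPT≤ALG = proj₂ (play-ratio A [] _ _ T F)

validJob? : ∀ j → Dec (ValidJob j)
validJob? j = (0ℚ ≤? t j) ×-dec (0ℚ ≤? p j) ×-dec (p j ≤? u j)

∀-Decision? : {P : Decision → Set} → (∀ d → Dec (P d)) → Dec (∀ d → P d)
∀-Decision? P? with P? (false , zero) | P? (false , suc zero) | P? (true , zero) | P? (true , suc zero)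
... | yes a | yes b | yes c | yes d = yes λ { (false , zero) → a ; (false , suc zero) → b ; (true , zero) → c ; (true , suc zero) → d }
... | no ¬a | _     | _     | _     = no λ all → ¬a (all _)
... | yes _ | no ¬b | _     | _     = no λ all → ¬b (all _)
... | yes _ | yes _ | no ¬c | _     = no λ all → ¬c (all _)
... | yes _ | yes _ | yes _ | no ¬d = no λ all → ¬d (all _)

forces? : ∀ ρ ls I T → Dec (Forces ρ ls I T)
forces? ρ (l₀ , l₁) I stop = (0ℚ <? OPT I) ×-dec (ρ * OPT I ≤? l₀ ⊔ l₁)
forces? ρ ls I (ask tⱼ uⱼ pⱼ next) = ∀-Decision? λ d → let j = job tⱼ uⱼ (pⱼ d) in
  validJob? j ×-dec forces? ρ (place d j ls) (I ++ [ j ]) (next d)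

spiteful : ℚ → Decision → ℚ
spiteful uⱼ (tested , _) = if tested then uⱼ else 0ℚ

probe : (tⱼ uⱼ : ℚ) → (Decision → Adversary) → Adversary
probe tⱼ uⱼ = ask tⱼ uⱼ (spiteful uⱼ)

thirdJob : (tested₁ tested₂ : Bool) → Adversary
thirdJob false false = probe (+ 3 / 2) (+ 11 / 5)  λ _ → stop
thirdJob false true  = probe (+ 2 / 1) (+ 3 / 1)   λ _ → stop
thirdJob true  false = probe (+ 9 / 4) (+ 67 / 20) λ _ → stop
thirdJob true  true  = probe (+ 7 / 2) (+ 51 / 10) λ _ → stop

secondJob : Decision → Adversary
secondJob (tested₁ , m₁) =
  probe (if tested₁ then + 3 / 4 else + 1 / 2) (if tested₁ then + 37 / 20 else + 11 / 10) λ (tested₂ , m₂) →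
    if does (m₁ Fin.≟ m₂) then stop else thirdJob tested₁ tested₂

adversary : Adversary
adversary = probe 1ℚ (+ 8 / 5) secondJob

adversary-forces-bound : Forces bound (0ℚ , 0ℚ) [] adversary
adversary-forces-bound = toWitness {a? = forces? bound (0ℚ , 0ℚ) [] adversary} tt

theorem8 : (A : Algorithm) (c : ℚ) → c < bound → ¬ Competitive A c
theorem8 A c c<bound = Forces⇒¬Competitive adversary adversary-forces-bound c<bound A
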